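{- Let $n \geq 6$ be an integer. If $T$ is a tree on $n$ vertices which is not isomorphic to the star $K_{1, n-1}$, then there exist two leaves $u$ and $v$ of $T$ such that $T - \{u, v\}$ is not isomorphic to $K_{1, n-3}$. -}

module Defs where

open import Data.Bool using (Bool; true; false; if_then_else_; _∧_; not; _xor_)
open import Data.Nat using (ℕ; suc; _≤_)
open import Data.Fin using (Fin; zero; suc)
open import Data.Fin.Properties using (_≟_)
open import Data.List using (List; []; _∷_; length; map; allFin)
open import Data.Nat.ListAction using (sum)
open import Data.List.Relation.Unary.Unique.Propositional using (Unique)
open import Data.Product using (Σ; Σ-syntax; _×_; proj₁)
open import Relation.Binary.PropositionalEquality using (_≡_; _≢_)
open import Relation.Nullary using (¬_; does)
open import Function.Bundles using (_↔_; Inverse)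

record Graph (V : Set) : Set where
  field
    Adj   : V → V → Bool
    sym   : ∀ x y → Adj x y ≡ Adj y x
    loopless : ∀ x → Adj x x ≡ false
open Graph public

data Walk {V : Set} (G : Graph V) : V → V → Set where
  nil  : ∀ {x} → Walk G x x
  cons : ∀ {x y z} → Adj G x y ≡ true → Walk G y z → Walk G x z

support : ∀ {V} {G : Graph V} {x y} → Walk G x y → List V
support {x = x} nil = x ∷ []
support {x = x} (cons _ w) = x ∷ support w

IsPath : ∀ {V} {G : Graph V} {x y} → Walk G x y → Set
IsPath w = Unique (support w)

Connected : ∀ {V} → Graph V → Set
Connected G = ∀ x y → Walk G x y

-- A cycle: an edge x–y together with a path y ⇝ x on at least 3 vertices
-- (so the cycle has length ≥ 3 and distinct vertices).
HasCycle : ∀ {V} → Graph V → Set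
HasCycle {V} G = Σ[ x ∈ V ] Σ[ y ∈ V ] (Adj G x y ≡ true) ×
                 (Σ[ p ∈ Walk G y x ] IsPath p × 3 ≤ length (support p))

Acyclic : ∀ {V} → Graph V → Set
Acyclic G = ¬ HasCycle G

IsTree : ∀ {V} → Graph V → Set
IsTree G = Connected G × Acyclic G

degree : ∀ {n} → Graph (Fin n) → Fin n → ℕ
degree {n} G x = sum (map (λ y → if Adj G x y then 1 else 0) (allFin n))

IsLeaf : ∀ {n} → Graph (Fin n) → Fin n → Set
IsLeaf G x = degree G x ≡ 1

_≅_ : ∀ {V W} → Graph V → Graph W → Set
_≅_ {V} {W} G H = Σ[ f ∈ V ↔ W ] (∀ x y → Adj H (Inverse.to f x) (Inverse.to f y) ≡ Adj G x y)

isZero : ∀ {k} → Fin k → Bool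
isZero zero = true
isZero (suc _) = false

star : (m : ℕ) → Graph (Fin (suc m))
star m = record
  { Adj = λ i j → isZero i xor isZero j
  ; sym = λ i j → xor-comm i j
  ; loopless = λ i → xor-self (isZero i)
  }
  where
  xor-self : ∀ b → b xor b ≡ false
  xor-self true = _≡_.refl
  xor-self false = _≡_.refl
  xor-comm : ∀ (i j : Fin (suc m)) → isZero i xor isZero j ≡ isZero j xor isZero i
  xor-comm i j with isZero i | isZero j
  ... | true  | true  = _≡_.refl
  ... | true  | false = _≡_.refl
  ... | false | true  = _≡_.refl
  ... | false | false = _≡_.refl

Remove2 : ∀ {n} → Fin n → Fin n → Set
Remove2 {n} u v = Σ[ x ∈ Fin n ] (x ≢ u × x ≢ v)

deleteTwo : ∀ {n} (G : Graph (Fin n)) (u v : Fin n) → Graph (Remove2 u v)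
deleteTwo G u v = record
  { Adj = λ x y → Adj G (proj₁ x) (proj₁ y)
  ; sym = λ x y → sym G (proj₁ x) (proj₁ y)
  ; loopless = λ x → loopless G (proj₁ x)
  }

{-# OPTIONS --safe #-}
-- Take two leaves u, v of T, hanging at a and b. If T - {u, v} has two disjoint edges, it is not
-- a star. Otherwise, T - {u, v} being triangle-free, all its edges pass through one vertex c; as
-- every vertex of T - {u, v} has a neighbour there (T is connected and n ≥ 6), c is adjacent to
-- all of T - {u, v}. If a = b = c, T is the star centred at c. Otherwise, say a ≠ c: then every
-- s ∉ {u, v, a, b, c} is a leaf at c, and T - {v, s} contains the disjoint edges u–a and t–c for
-- any further vertex t.
module Submission where

open import Defs
open import Level using (_⊔_; 0ℓ)
open import Function using (_∘_; id)
open import Function.Bundles using (_↔_; Inverse)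
open import Function.Definitions using (Injective)
open import Data.Bool using (Bool; true; false; if_then_else_; _xor_)
import Data.Bool as Bool
open import Data.Bool.Properties using (¬-not; not-¬)
open import Data.Empty using (⊥; ⊥-elim)
open import Data.Nat using (ℕ; zero; suc; _+_; _∸_; _≤_; _<_; z≤n; s≤s; z<s)
open import Data.Nat.Properties using (suc-injective; ≤-trans; <⇒≤; <⇒≱; m≤m+n; m<m+n; +-suc)
open import Data.Nat.ListAction using (sum)
open import Data.Fin using (Fin; zero; suc)
open import Data.Fin.Properties using (_≟_; any?; ¬∀⟶∃¬; injective⇒≤)
  renaming (suc-injective to Fin-suc-injective)
open import Data.Fin.Permutation using (transpose)
open import Data.List using (List; []; _∷_; length; lookup; tabulate)
open import Data.List.Properties using (map-tabulate)
open import Data.List.Membership.Propositional using (_∈_)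
open import Data.List.Membership.Propositional.Properties using (∈-lookup)
open import Data.List.Relation.Binary.Subset.Propositional using (_⊆_)
open import Data.List.Relation.Unary.Any using (here; there; index)
import Data.List.Relation.Unary.Any as Any
open import Data.List.Relation.Unary.Any.Properties using (lookup-index)
open import Data.List.Relation.Unary.All using (All; []; _∷_)
import Data.List.Relation.Unary.All as All
open import Data.List.Relation.Unary.All.Properties using (¬Any⇒All¬; anti-mono)
open import Data.List.Relation.Unary.AllPairs using ([]; _∷_)
open import Data.List.Relation.Unary.Unique.Propositional using (Unique)
open import Data.Product using (Σ-syntax; ∃; ∃₂; _×_; _,_; proj₁; proj₂; map₂)
open import Data.Sum using (_⊎_; inj₁; inj₂; [_,_]′)
import Data.Sum as Sum
open import Relation.Binary using (Rel)
open import Relation.Binary.Definitions using (Symmetric; Irreflexive; Decidable; DecidableEquality)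
open import Relation.Binary.PropositionalEquality as ≡ using (_≡_; _≢_; refl; cong; cong₂; subst; ≢-sym)
open import Relation.Nullary using (¬_; Dec; does; yes; no; ¬?; _×-dec_; contradiction)
open import Relation.Nullary.Decidable using (decidable-stable)
open import Relation.Unary using (Pred)

lookup-injective : ∀ {A : Set} {xs : List A} → Unique xs → Injective _≡_ _≡_ (lookup xs)
lookup-injective {xs = _ ∷ _} (_ ∷ _) {zero} {zero} _ = refl
lookup-injective {xs = _ ∷ _} (x∉ ∷ _) {zero} {suc j} eq = contradiction eq (All.lookup x∉ (∈-lookup j))
lookup-injective {xs = _ ∷ _} (x∉ ∷ _) {suc i} {zero} eq = contradiction (≡.sym eq) (All.lookup x∉ (∈-lookup i))
lookup-injective {xs = _ ∷ _} (_ ∷ xs-unique) {suc i} {suc j} eq = cong suc (lookup-injective xs-unique eq)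

unique⇒length≤ : ∀ {n} {xs : List (Fin n)} → Unique xs → length xs ≤ n
unique⇒length≤ xs-unique = injective⇒≤ (lookup-injective xs-unique)

fresh : ∀ {n} (xs : List (Fin n)) → length xs < n → ∃ λ y → All (y ≢_) xs
fresh {n} xs len<n = map₂ (¬Any⇒All¬ xs) (¬∀⟶∃¬ n (_∈ xs) (λ y → Any.any? (y ≟_) xs) not-all)
  where
  not-all : ¬ (∀ y → y ∈ xs)
  not-all all∈ = <⇒≱ len<n (injective⇒≤ {f = index ∘ all∈} index-injective)
    where
    index-injective : Injective _≡_ _≡_ (index ∘ all∈)
    index-injective {y} {z} eq =
      ≡.trans (lookup-index (all∈ y)) (≡.trans (cong (lookup xs) eq) (≡.sym (lookup-index (all∈ z))))

module _ {a ℓ} {A : Set a} (R : Rel A ℓ) where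

  Covers : A → Set (a ⊔ ℓ)
  Covers c = ∀ {x y} → R x y → x ≡ c ⊎ y ≡ c

  AvoidingEdge : A → Set (a ⊔ ℓ)
  AvoidingEdge c = ∃₂ λ x y → R x y × x ≢ c × y ≢ c

  DisjointEdges : Set (a ⊔ ℓ)
  DisjointEdges = ∃₂ λ x₁ x₂ → ∃₂ λ y₁ y₂ →
    R x₁ x₂ × R y₁ y₂ × x₁ ≢ y₁ × x₁ ≢ y₂ × x₂ ≢ y₁ × x₂ ≢ y₂

  TriangleFree : Set (a ⊔ ℓ)
  TriangleFree = ∀ {x y z} → R x y → R y z → R z x → ⊥

module _ {a ℓ} {A : Set a} {R : Rel A ℓ} where

  covers⇒¬disjointEdges : ∀ {c} → Covers R c → ¬ DisjointEdges R
  covers⇒¬disjointEdges cover (_ , _ , _ , _ , rx , ry , x₁≢y₁ , x₁≢y₂ , x₂≢y₁ , x₂≢y₂)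
    with cover rx | cover ry
  ... | inj₁ refl | inj₁ refl = x₁≢y₁ refl
  ... | inj₁ refl | inj₂ refl = x₁≢y₂ refl
  ... | inj₂ refl | inj₁ refl = x₂≢y₁ refl
  ... | inj₂ refl | inj₂ refl = x₂≢y₂ refl

  module _ (R-sym : Symmetric R) (R-irrefl : Irreflexive _≡_ R) (_≟ᴬ_ : DecidableEquality A) where

    disjointEdges-or-extension : ∀ {x y} → R x y → AvoidingEdge R x → DisjointEdges R ⊎ ∃ λ z → R y z × z ≢ x
    disjointEdges-or-extension {x} {y} rxy (p , q , rpq , p≢x , q≢x) with p ≟ᴬ y | q ≟ᴬ y
    ... | yes refl | _ = inj₂ (q , rpq , q≢x)
    ... | no _ | yes refl = inj₂ (p , R-sym rpq , p≢x)
    ... | no p≢y | no q≢y = inj₁ (x , y , p , q , rxy , rpq , ≢-sym p≢x , ≢-sym q≢x , ≢-sym p≢y , ≢-sym q≢y)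

    -- Two edges x–w and y–z sticking out of an edge x–y are disjoint unless w = z closes a triangle.
    disjointEdges-or-covered : TriangleFree R → (∀ c → Covers R c ⊎ AvoidingEdge R c) →
                               ∀ {x y} → R x y → DisjointEdges R ⊎ ∃ (Covers R)
    disjointEdges-or-covered no-triangle covers-or-avoiding {x} {y} rxy
      with covers-or-avoiding x | covers-or-avoiding y
    ... | inj₁ x-covers | _ = inj₂ (x , x-covers)
    ... | inj₂ _ | inj₁ y-covers = inj₂ (y , y-covers)
    ... | inj₂ avoiding-x | inj₂ avoiding-y
      with disjointEdges-or-extension rxy avoiding-x | disjointEdges-or-extension (R-sym rxy) avoiding-y
    ... | inj₁ disjoint | _ = inj₁ disjoint
    ... | inj₂ _ | inj₁ disjoint = inj₁ disjoint
    ... | inj₂ (z , ryz , z≢x) | inj₂ (w , rxw , w≢y) with w ≟ᴬ z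
    ...   | yes refl = ⊥-elim (no-triangle rxy ryz (R-sym rxw))
    ...   | no w≢z = inj₁ (x , w , y , z , rxw , ryz , (λ x≡y → R-irrefl x≡y rxy) , ≢-sym z≢x , w≢y , w≢z)

covers-or-avoidingEdge : ∀ {n ℓ} {R : Rel (Fin n) ℓ} → Decidable R → ∀ c → Covers R c ⊎ AvoidingEdge R c
covers-or-avoidingEdge {R = R} R? c with any? (λ x → any? (λ y → R? x y ×-dec ¬? (x ≟ c) ×-dec ¬? (y ≟ c)))
... | yes avoiding = inj₂ avoiding
... | no none = inj₁ covered
  where
  covered : Covers R c
  covered {x} {y} rxy with x ≟ c | y ≟ c
  ... | yes x≡c | _ = inj₁ x≡c
  ... | no _ | yes y≡c = inj₂ y≡c
  ... | no x≢c | no y≢c = ⊥-elim (none (x , y , rxy , x≢c , y≢c))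

count : ∀ {n} → (Fin n → Bool) → ℕ
count f = sum (tabulate (λ y → if f y then 1 else 0))

false⇒count≡0 : ∀ {n} (f : Fin n → Bool) → (∀ y → f y ≡ false) → count f ≡ 0
false⇒count≡0 {zero} f _ = refl
false⇒count≡0 {suc n} f f≡false rewrite f≡false zero = false⇒count≡0 (f ∘ suc) (f≡false ∘ suc)

count≡0⇒false : ∀ {n} (f : Fin n → Bool) → count f ≡ 0 → ∀ y → f y ≡ false
count≡0⇒false {suc n} f c y with f zero in f₀
count≡0⇒false {suc n} f () y | true
count≡0⇒false {suc n} f c zero | false = f₀
count≡0⇒false {suc n} f c (suc y) | false = count≡0⇒false (f ∘ suc) c y

count≡1⇒unique : ∀ {n} (f : Fin n → Bool) → count f ≡ 1 → ∃ λ p → f p ≡ true × ∀ {y} → f y ≡ true → y ≡ p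
count≡1⇒unique {suc n} f c with f zero in f₀
... | true = zero , f₀ , only-zero
  where
  only-zero : ∀ {y} → f y ≡ true → y ≡ zero
  only-zero {zero} _ = refl
  only-zero {suc y} fy = contradiction (count≡0⇒false (f ∘ suc) (suc-injective c) y) (not-¬ fy)
... | false with count≡1⇒unique (f ∘ suc) c
...   | p , fp , unique = suc p , fp , only-suc-p
  where
  only-suc-p : ∀ {y} → f y ≡ true → y ≡ suc p
  only-suc-p {zero} fy = contradiction f₀ (not-¬ fy)
  only-suc-p {suc y} fy = cong suc (unique fy)

unique⇒count≡1 : ∀ {n} (f : Fin n → Bool) {p} → f p ≡ true → (∀ {y} → f y ≡ true → y ≡ p) → count f ≡ 1
unique⇒count≡1 {suc n} f {zero} fp unique rewrite fp =
  cong suc (false⇒count≡0 (f ∘ suc) (λ y → ¬-not (λ fy → contradiction (unique fy) λ ())))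
unique⇒count≡1 {suc n} f {suc p} fp unique with f zero in f₀
... | true = contradiction (unique f₀) λ ()
... | false = unique⇒count≡1 (f ∘ suc) fp (Fin-suc-injective ∘ unique)

degree≡count : ∀ {n} (G : Graph (Fin n)) x → degree G x ≡ count (Adj G x)
degree≡count G x = cong sum (map-tabulate id (λ y → if Adj G x y then 1 else 0))

Adjacent : ∀ {V : Set} → Graph V → Rel V 0ℓ
Adjacent G x y = Adj G x y ≡ true

-- G - {u, v} described inside the vertex type of G rather than on Remove2 u v, whose elements carry proofs.
Outside : ∀ {V : Set} → V → V → V → Set
Outside u v x = x ≢ u × x ≢ v

outside? : ∀ {n} (u v x : Fin n) → Dec (Outside u v x)
outside? u v x = ¬? (x ≟ u) ×-dec ¬? (x ≟ v)

EdgeOutside : ∀ {V : Set} → Graph V → V → V → Rel V 0ℓ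
EdgeOutside G u v x y = Outside u v x × Outside u v y × Adjacent G x y

LeafPair : ∀ {n} → Graph (Fin n) → Fin n → Fin n → Set
LeafPair G u v = u ≢ v × IsLeaf G u × IsLeaf G v

StarCentre : ∀ {V : Set} → Graph V → V → Set
StarCentre G c = (∀ {y} → y ≢ c → Adjacent G c y) × Covers (Adjacent G) c

module WalkProperties {V : Set} (G : Graph V) where

  infix 4 _~_
  _~_ : Rel V 0ℓ
  _~_ = Adjacent G

  ~-sym : Symmetric _~_
  ~-sym {x} {y} x~y = ≡.trans (sym G y x) x~y

  ~-irrefl : Irreflexive _≡_ _~_
  ~-irrefl {x} refl x~x = not-¬ x~x (loopless G x)

  ~⇒≢ : ∀ {x y} → x ~ y → x ≢ y
  ~⇒≢ x~y x≡y = ~-irrefl x≡y x~y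

  walk-preserves : ∀ {ℓ} (P : Pred V ℓ) → (∀ {x y} → P x → x ~ y → P y) →
                   ∀ {x y} → Walk G x y → P x → P y
  walk-preserves P step nil px = px
  walk-preserves P step (cons x~z w) px = walk-preserves P step w (step px x~z)

  end∈support : ∀ {x y} (w : Walk G x y) → y ∈ support w
  end∈support nil = here refl
  end∈support (cons _ w) = there (end∈support w)

  1≤length-support : ∀ {x y} (w : Walk G x y) → 1 ≤ length (support w)
  1≤length-support nil = s≤s z≤n
  1≤length-support (cons _ _) = s≤s z≤n

  prefix : ∀ {x y z} (w : Walk G x z) → IsPath w → y ∈ support w →
           ∃ λ (p : Walk G x y) → IsPath p × support p ⊆ support w
  prefix nil w-path (here refl) = nil , w-path , id
  prefix (cons _ _) _ (here refl) = nil , [] ∷ [] , λ { (here refl) → here refl }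
  prefix (cons x~z w) (x∉w ∷ w-path) (there y∈w) with prefix w w-path y∈w
  ... | p , p-path , p⊆w = cons x~z p , anti-mono p⊆w x∉w ∷ p-path , λ where
        (here refl) → here refl
        (there t∈p) → there (p⊆w t∈p)

  acyclic⇒triangleFree : Acyclic G → TriangleFree _~_
  acyclic⇒triangleFree acyclic x~y y~z z~x =
    acyclic (_ , _ , x~y , cons y~z (cons z~x nil) , yzx-path , s≤s (s≤s (s≤s z≤n)))
    where
    yzx-path : IsPath {G = G} (cons y~z (cons z~x nil))
    yzx-path = (~⇒≢ y~z ∷ ≢-sym (~⇒≢ x~y) ∷ []) ∷ (~⇒≢ z~x ∷ []) ∷ [] ∷ []

  -- Any other neighbour y of x further along the path would close the cycle x, p, …, y, x.
  acyclic-path-neighbour : Acyclic G → ∀ {x p s y} (x~p : x ~ p) (w : Walk G p s) →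
                           IsPath (cons x~p w) → x ~ y → y ∈ support w → y ≡ p
  acyclic-path-neighbour _ _ nil _ _ (here refl) = refl
  acyclic-path-neighbour _ _ (cons _ _) _ _ (here refl) = refl
  acyclic-path-neighbour acyclic x~p (cons p~q w) ((x≢p ∷ x∉w) ∷ p∉w ∷ w-path) x~y (there y∈w)
    with prefix w w-path y∈w
  ... | r , r-path , r⊆w =
    ⊥-elim (acyclic (_ , _ , ~-sym x~y , cons x~p (cons p~q r) , cycle-path , s≤s (s≤s (1≤length-support r))))
    where
    cycle-path : IsPath {G = G} (cons x~p (cons p~q r))
    cycle-path = (x≢p ∷ anti-mono r⊆w x∉w) ∷ anti-mono r⊆w p∉w ∷ r-path

module LeafProperties {n} (G : Graph (Fin n)) where

  open WalkProperties G

  _~?_ : Decidable _~_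
  x ~? y = Adj G x y Bool.≟ true

  leaf⇒uniqueNeighbour : ∀ {x} → IsLeaf G x → ∃ λ p → x ~ p × ∀ {y} → x ~ y → y ≡ p
  leaf⇒uniqueNeighbour {x} leaf = count≡1⇒unique (Adj G x) (≡.trans (≡.sym (degree≡count G x)) leaf)

  uniqueNeighbour⇒leaf : ∀ {x p} → x ~ p → (∀ {y} → x ~ y → y ≡ p) → IsLeaf G x
  uniqueNeighbour⇒leaf {x} x~p unique = ≡.trans (degree≡count G x) (unique⇒count≡1 (Adj G x) x~p unique)

  leaf-neighbour-unique : ∀ {x y z} → IsLeaf G x → x ~ y → x ~ z → y ≡ z
  leaf-neighbour-unique leaf x~y x~z with leaf⇒uniqueNeighbour leaf
  ... | _ , _ , unique = ≡.trans (unique x~y) (≡.sym (unique x~z))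

  leaf-neighbours⇒dominating : Connected G → ∀ {x} → (∀ {y} → x ~ y → IsLeaf G y) → ∀ z → z ≡ x ⊎ x ~ z
  leaf-neighbours⇒dominating connected {x} leaves z = walk-preserves P step (connected x z) (inj₁ refl)
    where
    P : Pred (Fin n) 0ℓ
    P z = z ≡ x ⊎ x ~ z
    step : ∀ {p q} → P p → p ~ q → P q
    step (inj₁ refl) x~q = inj₂ x~q
    step (inj₂ x~p) p~q = inj₁ (leaf-neighbour-unique (leaves x~p) p~q (~-sym x~p))

  leaf-neighbour-not-leaf : Connected G → 2 < n → ∀ {u a} → IsLeaf G u → u ~ a → ¬ IsLeaf G a
  leaf-neighbour-not-leaf connected 2<n {u} {a} leaf-u u~a leaf-a with fresh (u ∷ a ∷ []) 2<n
  ... | z , z≢u ∷ z≢a ∷ [] with leaf-neighbours⇒dominating connected only-a z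
    where
    only-a : ∀ {y} → u ~ y → IsLeaf G y
    only-a u~y = subst (IsLeaf G) (leaf-neighbour-unique leaf-u u~a u~y) leaf-a
  ... | inj₁ z≡u = z≢u z≡u
  ... | inj₂ u~z = z≢a (leaf-neighbour-unique leaf-u u~z u~a)

  ¬neighbours⊆leaves : Connected G → 3 < n → ∀ {u v w} → IsLeaf G u → IsLeaf G v →
                       ¬ (∀ {y} → w ~ y → y ≡ u ⊎ y ≡ v)
  ¬neighbours⊆leaves connected 3<n {u} {v} {w} leaf-u leaf-v ⊆uv with fresh (w ∷ u ∷ v ∷ []) 3<n
  ... | z , z≢w ∷ z≢u ∷ z≢v ∷ [] with leaf-neighbours⇒dominating connected leaves z
    where
    leaves : ∀ {y} → w ~ y → IsLeaf G y
    leaves w~y = [ (λ { refl → leaf-u }) , (λ { refl → leaf-v }) ]′ (⊆uv w~y)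
  ... | inj₁ z≡w = z≢w z≡w
  ... | inj₂ w~z = [ z≢u , z≢v ]′ (⊆uv w~z)

  outside-neighbour : Connected G → 3 < n → ∀ {u v} → IsLeaf G u → IsLeaf G v →
                      ∀ w → ∃ λ y → Outside u v y × w ~ y
  outside-neighbour connected 3<n {u} {v} leaf-u leaf-v w
    with any? (λ y → outside? u v y ×-dec w ~? y)
  ... | yes found = found
  ... | no none = ⊥-elim (¬neighbours⊆leaves connected 3<n leaf-u leaf-v ⊆uv)
    where
    ⊆uv : ∀ {y} → w ~ y → y ≡ u ⊎ y ≡ v
    ⊆uv {y} w~y with y ≟ u | y ≟ v
    ... | yes y≡u | _ = inj₁ y≡u
    ... | no _ | yes y≡v = inj₂ y≡v
    ... | no y≢u | no y≢v = ⊥-elim (none (y , (y≢u , y≢v) , w~y))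

  edge-outside : Connected G → 3 < n → ∀ {u v} → IsLeaf G u → IsLeaf G v → ∃₂ (EdgeOutside G u v)
  edge-outside connected 3<n {u} leaf-u leaf-v with outside-neighbour connected 3<n leaf-u leaf-v u
  ... | y , y-out , _ with outside-neighbour connected 3<n leaf-u leaf-v y
  ... | z , z-out , y~z = y , z , y-out , z-out , y~z

  -- Extend the path at its head x while possible; a path has at most n vertices, so the fuel never runs out.
  maximal-path-leaf : Acyclic G → ∀ fuel {x p s} (x~p : x ~ p) (w : Walk G p s) → IsPath (cons x~p w) →
                      n < fuel + length (support (cons x~p w)) → ∃ λ z → IsLeaf G z × z ≢ s
  maximal-path-leaf acyclic zero x~p w path n<length = ⊥-elim (<⇒≱ n<length (unique⇒length≤ path))
  maximal-path-leaf acyclic (suc fuel) {x} {p} x~p w path@(x∉w ∷ w-path) n<length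
    with any? (λ y → x ~? y ×-dec ¬? (Any.any? (y ≟_) (support (cons x~p w))))
  ... | yes (y , x~y , y∉path) =
    maximal-path-leaf acyclic fuel (~-sym x~y) (cons x~p w) (¬Any⇒All¬ _ y∉path ∷ path)
      (subst (n <_) (≡.sym (+-suc fuel _)) n<length)
  ... | no stuck = x , uniqueNeighbour⇒leaf x~p only-p , λ { refl → All.lookup x∉w (end∈support w) refl }
    where
    only-p : ∀ {y} → x ~ y → y ≡ p
    only-p {y} x~y with decidable-stable (Any.any? (y ≟_) _) (λ y∉path → stuck (y , x~y , y∉path))
    ... | here refl = ⊥-elim (~⇒≢ x~y refl)
    ... | there y∈w = acyclic-path-neighbour acyclic x~p w path x~y y∈w

  leaf-beyond : Acyclic G → ∀ {x y} → y ~ x → ∃ λ z → IsLeaf G z × z ≢ x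
  leaf-beyond acyclic y~x = maximal-path-leaf acyclic n y~x nil ((~⇒≢ y~x ∷ []) ∷ [] ∷ []) (m<m+n n z<s)

  two-leaves : Acyclic G → ∀ {x y} → x ~ y → ∃₂ (LeafPair G)
  two-leaves acyclic x~y with leaf-beyond acyclic x~y
  ... | u , leaf-u , _ with leaf⇒uniqueNeighbour leaf-u
  ... | _ , u~a , _ with leaf-beyond acyclic (~-sym u~a)
  ... | v , leaf-v , v≢u = v , u , v≢u , leaf-v , leaf-u

  connected⇒edge : Connected G → 1 < n → ∃₂ _~_
  connected⇒edge connected 1<n with fresh [] (<⇒≤ 1<n)
  ... | x , [] with fresh (x ∷ []) 1<n
  ... | y , y≢x ∷ [] = first-step (connected x y)
    where
    first-step : Walk G x y → ∃₂ _~_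
    first-step nil = ⊥-elim (y≢x refl)
    first-step (cons x~z _) = _ , _ , x~z

module _ {n} (G : Graph (Fin n)) {u v : Fin n} where

  open WalkProperties G

  edgeOutside-sym : Symmetric (EdgeOutside G u v)
  edgeOutside-sym (x-out , y-out , x~y) = y-out , x-out , ~-sym x~y

  edgeOutside-irrefl : Irreflexive _≡_ (EdgeOutside G u v)
  edgeOutside-irrefl x≡y (_ , _ , x~y) = ~-irrefl x≡y x~y

  edgeOutside-triangleFree : Acyclic G → TriangleFree (EdgeOutside G u v)
  edgeOutside-triangleFree acyclic (_ , _ , x~y) (_ , _ , y~z) (_ , _ , z~x) =
    acyclic⇒triangleFree acyclic x~y y~z z~x

  edgeOutside? : Decidable (EdgeOutside G u v)
  edgeOutside? x y = outside? u v x ×-dec outside? u v y ×-dec LeafProperties._~?_ G x y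

  edgeOutside-swap : ∀ {x y} → EdgeOutside G v u x y → EdgeOutside G u v x y
  edgeOutside-swap ((x≢v , x≢u) , (y≢v , y≢u) , x~y) = (x≢u , x≢v) , (y≢u , y≢v) , x~y

star-covered : ∀ {m} → Covers (Adjacent (star m)) zero
star-covered {x = zero} _ = inj₁ refl
star-covered {x = suc _} {zero} _ = inj₂ refl

≅star⇒covered : ∀ {V : Set} {G : Graph V} {m} → G ≅ star m → ∃ (Covers (Adjacent G))
≅star⇒covered (f , to-adjacent) =
  from zero , λ {x} {y} x~y → Sum.map (to≡zero⇒ x) (to≡zero⇒ y) (star-covered (≡.trans (to-adjacent x y) x~y))
  where
  open Inverse f
  to≡zero⇒ : ∀ x → to x ≡ zero → x ≡ from zero
  to≡zero⇒ x to-x≡zero = ≡.sym (inverseʳ (≡.sym to-x≡zero))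

disjointEdgesOutside⇒¬≅star : ∀ {n m} {G : Graph (Fin n)} {u v} →
                              DisjointEdges (EdgeOutside G u v) → ¬ (deleteTwo G u v ≅ star m)
disjointEdgesOutside⇒¬≅star {G = G} {u} {v} (x₁ , x₂ , y₁ , y₂ , (o₁ , o₂ , x₁~x₂) , (o₃ , o₄ , y₁~y₂) , x₁≢y₁ , x₁≢y₂ , x₂≢y₁ , x₂≢y₂) iso =
  covers⇒¬disjointEdges (proj₂ (≅star⇒covered {G = deleteTwo G u v} iso))
    ( (x₁ , o₁) , (x₂ , o₂) , (y₁ , o₃) , (y₂ , o₄) , x₁~x₂ , y₁~y₂
    , x₁≢y₁ ∘ cong proj₁ , x₁≢y₂ ∘ cong proj₁ , x₂≢y₁ ∘ cong proj₁ , x₂≢y₂ ∘ cong proj₁)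

≢zero⇒isZero≡false : ∀ {k} (i : Fin (suc k)) → i ≢ zero → isZero i ≡ false
≢zero⇒isZero≡false zero i≢zero = contradiction refl i≢zero
≢zero⇒isZero≡false (suc _) _ = refl

centre↦zero⇒≅star : ∀ {m} {G : Graph (Fin (suc m))} {c} → StarCentre G c →
                    (f : Fin (suc m) ↔ Fin (suc m)) → Inverse.to f c ≡ zero → G ≅ star m
centre↦zero⇒≅star {m} {G} {c} (c~others , covered) f to-c≡zero = f , adjacency
  where
  open WalkProperties G
  open Inverse f

  isZero-to : ∀ x → isZero (to x) ≡ does (x ≟ c)
  isZero-to x with x ≟ c
  ... | yes refl = cong isZero to-c≡zero
  ... | no x≢c = ≢zero⇒isZero≡false (to x) λ to-x≡zero →
    x≢c (≡.trans (≡.sym (strictlyInverseʳ x)) (≡.trans (cong from (≡.trans to-x≡zero (≡.sym to-c≡zero))) (strictlyInverseʳ c)))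

  centre-adjacency : ∀ x y → does (x ≟ c) xor does (y ≟ c) ≡ Adj G x y
  centre-adjacency x y with x ≟ c | y ≟ c
  ... | yes refl | yes refl = ≡.sym (loopless G c)
  ... | yes refl | no y≢c = ≡.sym (c~others y≢c)
  ... | no x≢c | yes refl = ≡.sym (~-sym (c~others x≢c))
  ... | no x≢c | no y≢c = ≡.sym (¬-not λ x~y → [ x≢c , y≢c ]′ (covered x~y))

  adjacency : ∀ x y → Adj (star m) (to x) (to y) ≡ Adj G x y
  adjacency x y = ≡.trans (cong₂ _xor_ (isZero-to x) (isZero-to y)) (centre-adjacency x y)

starCentre⇒≅star : ∀ {m} {G : Graph (Fin (suc m))} {c} → StarCentre G c → G ≅ star m
starCentre⇒≅star {G = G} {c} centre =
  centre↦zero⇒≅star {G = G} centre (transpose c zero) (Inverse.strictlyInverseˡ (transpose c zero) zero)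

module Covered {n} {G : Graph (Fin n)} (connected : Connected G) (3<n : 3 < n) {u v c}
               (leaf-u : IsLeaf G u) (leaf-v : IsLeaf G v) (cover : Covers (EdgeOutside G u v) c) where

  open WalkProperties G
  open LeafProperties G

  outside⇒~centre : ∀ {w} → Outside u v w → w ≢ c → w ~ c
  outside⇒~centre {w} w-out w≢c with outside-neighbour connected 3<n leaf-u leaf-v w
  ... | y , y-out , w~y with cover (w-out , y-out , w~y)
  ... | inj₁ w≡c = ⊥-elim (w≢c w≡c)
  ... | inj₂ refl = w~y

  centre⇒starCentre : u ~ c → v ~ c → StarCentre G c
  centre⇒starCentre u~c v~c = c~others , covered
    where
    c~others : ∀ {y} → y ≢ c → c ~ y
    c~others {y} y≢c with y ≟ u | y ≟ v
    ... | yes refl | _ = ~-sym u~c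
    ... | no _ | yes refl = ~-sym v~c
    ... | no y≢u | no y≢v = ~-sym (outside⇒~centre (y≢u , y≢v) y≢c)

    outside-or-to-centre : ∀ {x y} → x ~ y → Outside u v x ⊎ y ≡ c
    outside-or-to-centre {x} x~y with x ≟ u | x ≟ v
    ... | yes refl | _ = inj₂ (leaf-neighbour-unique leaf-u x~y u~c)
    ... | no _ | yes refl = inj₂ (leaf-neighbour-unique leaf-v x~y v~c)
    ... | no x≢u | no x≢v = inj₁ (x≢u , x≢v)

    covered : Covers _~_ c
    covered x~y with outside-or-to-centre x~y | outside-or-to-centre (~-sym x~y)
    ... | inj₂ y≡c | _ = inj₂ y≡c
    ... | inj₁ _ | inj₂ x≡c = inj₁ x≡c
    ... | inj₁ x-out | inj₁ y-out = cover (x-out , y-out , x~y)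

  other-leaf : 5 < n → u ≢ v → Outside u v c → ∀ {a b} → u ~ a → a ≢ c → v ~ b →
               ∃ λ s → LeafPair G v s × DisjointEdges (EdgeOutside G v s)
  other-leaf 5<n u≢v (c≢u , c≢v) {a} {b} u~a a≢c v~b with fresh (u ∷ v ∷ c ∷ a ∷ b ∷ []) 5<n
  ... | s , s≢u ∷ s≢v ∷ s≢c ∷ s≢a ∷ s≢b ∷ [] with fresh (u ∷ v ∷ c ∷ a ∷ s ∷ []) 5<n
  ... | t , t≢u ∷ t≢v ∷ t≢c ∷ t≢a ∷ t≢s ∷ [] =
    s , (≢-sym s≢v , leaf-v , leaf-s) ,
    ( u , a , t , c
    , ((u≢v , ≢-sym s≢u) , (a≢v , ≢-sym s≢a) , u~a)
    , ((t≢v , t≢s) , (c≢v , ≢-sym s≢c) , outside⇒~centre (t≢u , t≢v) t≢c)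
    , ≢-sym t≢u , ≢-sym c≢u , ≢-sym t≢a , a≢c)
    where
    a≢v : a ≢ v
    a≢v a≡v = leaf-neighbour-not-leaf connected (<⇒≤ 3<n) leaf-u u~a (subst (IsLeaf G) (≡.sym a≡v) leaf-v)

    only-c : ∀ {y} → s ~ y → y ≡ c
    only-c {y} s~y with y ≟ u | y ≟ v
    ... | yes refl | _ = ⊥-elim (s≢a (leaf-neighbour-unique leaf-u (~-sym s~y) u~a))
    ... | no _ | yes refl = ⊥-elim (s≢b (leaf-neighbour-unique leaf-v (~-sym s~y) v~b))
    ... | no y≢u | no y≢v with cover ((s≢u , s≢v) , (y≢u , y≢v) , s~y)
    ...   | inj₁ s≡c = ⊥-elim (s≢c s≡c)
    ...   | inj₂ y≡c = y≡c

    leaf-s : IsLeaf G s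
    leaf-s = uniqueNeighbour⇒leaf (outside⇒~centre (s≢u , s≢v) s≢c) only-c

module _ {n} {T : Graph (Fin n)} (6≤n : 6 ≤ n) (connected : Connected T) (acyclic : Acyclic T) where

  open LeafProperties T

  3<n : 3 < n
  3<n = ≤-trans (m≤m+n 4 2) 6≤n

  covered-leaf-pair : ∀ {u v c} → LeafPair T u v → Outside u v c → Covers (EdgeOutside T u v) c →
                      ¬ StarCentre T c → ∃₂ λ u′ v′ → LeafPair T u′ v′ × DisjointEdges (EdgeOutside T u′ v′)
  covered-leaf-pair {u} {v} {c} (u≢v , leaf-u , leaf-v) (c≢u , c≢v) cover not-star
    with leaf⇒uniqueNeighbour leaf-u | leaf⇒uniqueNeighbour leaf-v
  ... | a , u~a , _ | b , v~b , _ with a ≟ c | b ≟ c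
  ... | yes refl | yes refl = ⊥-elim (not-star (Covered.centre⇒starCentre connected 3<n leaf-u leaf-v cover u~a v~b))
  ... | no a≢c | _ = v , Covered.other-leaf connected 3<n leaf-u leaf-v cover 6≤n u≢v (c≢u , c≢v) u~a a≢c v~b
  ... | yes _ | no b≢c = u , Covered.other-leaf connected 3<n leaf-v leaf-u (cover ∘ edgeOutside-swap T) 6≤n
                                (≢-sym u≢v) (c≢v , c≢u) v~b b≢c u~a

  leaf-pair-with-disjoint-edges-outside : (∀ c → ¬ StarCentre T c) →
                                          ∃₂ λ u v → LeafPair T u v × DisjointEdges (EdgeOutside T u v)
  leaf-pair-with-disjoint-edges-outside not-star
    with connected⇒edge connected (≤-trans (m≤m+n 2 4) 6≤n)
  ... | _ , _ , x~y with two-leaves acyclic x~y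
  ... | u , v , pair@(_ , leaf-u , leaf-v) with edge-outside connected 3<n leaf-u leaf-v
  ... | y , z , y~z@(y-out , z-out , _)
    with disjointEdges-or-covered (edgeOutside-sym T) (edgeOutside-irrefl T) _≟_ (edgeOutside-triangleFree T acyclic)
           (covers-or-avoidingEdge (edgeOutside? T)) y~z
  ... | inj₁ disjoint = u , v , pair , disjoint
  ... | inj₂ (c , cover) = covered-leaf-pair pair c-out cover (not-star c)
    where
    c-out : Outside u v c
    c-out = [ (λ { refl → y-out }) , (λ { refl → z-out }) ]′ (cover y~z)

lemma13 : (n : ℕ) → 6 ≤ n → (T : Graph (Fin n)) → IsTree T →
          ¬ (T ≅ star (n ∸ 1)) →
          Σ[ u ∈ Fin n ] Σ[ v ∈ Fin n ] (u ≢ v × IsLeaf T u × IsLeaf T v ×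
            ¬ (deleteTwo T u v ≅ star (n ∸ 3)))
lemma13 (suc m) 6≤n T (connected , acyclic) not-star =
  let u , v , (u≢v , leaf-u , leaf-v) , disjoint =
        leaf-pair-with-disjoint-edges-outside 6≤n connected acyclic (λ c → not-star ∘ starCentre⇒≅star {G = T})
  in u , v , u≢v , leaf-u , leaf-v , disjointEdgesOutside⇒¬≅star {G = T} disjoint
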